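{- Let $\mathcal{S}$ be the class of axiom schemata that are characteristic of $\mathbf{L_1}$ and nontrivial with respect to $(\mathrm{A_t})$, and for $x,y\in\mathcal{S}$ write $x<_{QT}y$ iff $x$ is quasi-trivial with respect to $y$. Then for all $x,y,z\in\mathcal{S}$: (1) $<_{QT}$ is reflexive and symmetric; (2) if $\#nv(x)\le\#nv(y)\le\#nv(z)$, $x<_{QT}y$ and $y<_{QT}z$, then $x<_{QT}z$; (3) if $\#nv(x)\ge\#nv(y)\ge\#nv(z)$, $x<_{QT}y$ and $y<_{QT}z$, then $x<_{QT}z$.
   Context: $\mathbf{L_1}$: formulas built from atomic $\epsilon xy$ ($x,y$ name variables) by $\neg,\vee$ (other connectives defined); $\mathbf{L_1}$ is the closure under modus ponens of all instances of classical tautologies and all instances of (Ax1) $\epsilon ab\supset\epsilon aa$, (Ax2) $(\epsilon ab\wedge\epsilon bc)\supset\epsilon ac$, (Ax3) $(\epsilon ab\wedge\epsilon bc)\supset\epsilon ba$. A schema $A$ is characteristic of $\mathbf{L_1}$ if the closure under modus ponens of all tautology instances and all instances of $A$ (substituting name variables for name variables) equals $\mathbf{L_1}$. A formula is an instance of a tautology if it is a tautology when distinct atomic formulas are treated as distinct propositional atoms. $nv(A)$: the tuple of distinct name variables of $A$ in order of first occurrence; $\#nv(A)$ its length. $(\mathrm{A_t})$: $\epsilon ab\supset(\epsilon aa\wedge(\epsilon bc\supset(\epsilon ac\wedge\epsilon ba)))$. Trivial w.r.t. $(\mathrm{A_t})$: $A$ with $nv(A)=(x_1,\dots,x_n)$,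 $n\ge3$, is trivial if for some permutation $\rho$ and distinct fresh name variables $y_1,\dots,y_{n-3}$ (not among the $x_i$ nor $a,b,c$), the substitution $\sigma$ sending $x_{\rho(1)},x_{\rho(2)},x_{\rho(3)}$ to $a,b,c$ and $x_{\rho(3+j)}$ to $y_j$ makes $\sigma(A)\equiv(\mathrm{A_t})$ a tautology instance; nontrivial means not trivial. Quasi-trivial: for $nv(A)=(x_1,\dots,x_n)$, $nv(B)=(y_1,\dots,y_m)$, $n,m\ge3$, $A$ is quasi-trivial w.r.t. $B$ if (when $n\le m$) for some permutation $\rho$ of $\{1,\dots,m\}$ and distinct name variables $u_1,\dots,u_{m-n}$ not among the $x_i,y_j$, the substitution $\sigma$ sending $y_{\rho(i)}$ to $x_i$ ($i\le n$) and $y_{\rho(n+j)}$ to $u_j$ makes $\sigma(B)\equiv A$ a tautology instance; or (when $n>m$) for some permutation $\rho$ of $\{1,\dots,n\}$ and distinct name variables $v_1,\dots,v_{n-m}$ not among the $x_i,y_j$, the substitution $\sigma$ sending $x_{\rho(i)}$ to $y_i$ ($i\le m$) and $x_{\rho(m+j)}$ to $v_j$ makes $\sigma(A)\equiv B$ a tautology instance. -}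

module Defs where

open import Data.Nat using (ℕ; zero; suc; _∸_; _<_; _≤_; _≥_)
open import Data.Nat.Properties using (_≟_)
open import Data.Bool using (Bool; true; false; not; _∨_)
open import Data.List using (List; []; _∷_; _++_; length; deduplicate)
open import Data.List.Membership.Propositional using (_∈_)
open import Data.Fin using (Fin; toℕ)
open import Data.Fin.Permutation using (Permutation′; _⟨$⟩ʳ_)
open import Data.Product using (Σ; ∃; _×_; _,_)
open import Data.Sum using (_⊎_)
open import Relation.Binary.PropositionalEquality using (_≡_; _≢_)
open import Relation.Nullary using (¬_)

NV : Set
NV = ℕ

data Fm : Set where
  ε   : NV → NV → Fm
  ~_  : Fm → Fm
  _∨′_ : Fm → Fm → Fm

infix  9 ~_
infixr 6 _∨′_
infixr 5 _∧′_
infixr 4 _⊃_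
infix  3 _⇔_

_⊃_ : Fm → Fm → Fm
φ ⊃ ψ = ~ φ ∨′ ψ

_∧′_ : Fm → Fm → Fm
φ ∧′ ψ = ~ (~ φ ∨′ ~ ψ)

_⇔_ : Fm → Fm → Fm
φ ⇔ ψ = (φ ⊃ ψ) ∧′ (ψ ⊃ φ)

eval : (NV → NV → Bool) → Fm → Bool
eval v (ε x y) = v x y
eval v (~ φ) = not (eval v φ)
eval v (φ ∨′ ψ) = eval v φ ∨ eval v ψ

Taut : Fm → Set
Taut φ = ∀ (v : NV → NV → Bool) → eval v φ ≡ true

sub : (NV → NV) → Fm → Fm
sub σ (ε x y) = ε (σ x) (σ y)
sub σ (~ φ) = ~ sub σ φ
sub σ (φ ∨′ ψ) = sub σ φ ∨′ sub σ ψ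

Inst : Fm → Fm → Set
Inst A φ = Σ (NV → NV) λ σ → φ ≡ sub σ A

data Deriv (Ax : Fm → Set) : Fm → Set where
  taut : ∀ {φ} → Taut φ → Deriv Ax φ
  ax   : ∀ {φ} → Ax φ → Deriv Ax φ
  mp   : ∀ {φ ψ} → Deriv Ax φ → Deriv Ax (φ ⊃ ψ) → Deriv Ax ψ

va vb vc : NV
va = 0
vb = 1
vc = 2

Ax1 Ax2 Ax3 : Fm
Ax1 = ε va vb ⊃ ε va va
Ax2 = (ε va vb ∧′ ε vb vc) ⊃ ε va vc
Ax3 = (ε va vb ∧′ ε vb vc) ⊃ ε vb va

L1Ax : Fm → Set
L1Ax φ = Inst Ax1 φ ⊎ Inst Ax2 φ ⊎ Inst Ax3 φ

L1 : Fm → Set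
L1 = Deriv L1Ax

Characteristic : Fm → Set
Characteristic A = ∀ φ → (Deriv (Inst A) φ → L1 φ) × (L1 φ → Deriv (Inst A) φ)

At : Fm
At = ε va vb ⊃ (ε va va ∧′ (ε vb vc ⊃ (ε va vc ∧′ ε vb va)))

occ : Fm → List NV
occ (ε x y) = x ∷ y ∷ []
occ (~ φ) = occ φ
occ (φ ∨′ ψ) = occ φ ++ occ ψ

-- nv(A): distinct name variables in order of first occurrence.
nv : Fm → List NV
nv A = deduplicate _≟_ (occ A)

#nv : Fm → ℕ
#nv A = length (nv A)

-- i-th element (0-based) of a list, with a default 0 out of range
-- (only ever used in range).
at : List NV → ℕ → NV
at [] i = 0
at (x ∷ xs) zero = x
at (x ∷ xs) (suc i) = at xs i

tgt : (ℕ → NV) → ℕ → NV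
tgt y 0 = va
tgt y 1 = vb
tgt y 2 = vc
tgt y (suc (suc (suc j))) = y j

DistinctUpTo : ℕ → (ℕ → NV) → Set
DistinctUpTo k u = ∀ i j → i < k → j < k → u i ≡ u j → i ≡ j

Trivial : Fm → Set
Trivial A =
  3 ≤ #nv A ×
  Σ (Permutation′ (#nv A)) λ ρ →
  Σ (ℕ → NV) λ y →
    DistinctUpTo (#nv A ∸ 3) y ×
    (∀ j → j < #nv A ∸ 3 → ¬ (y j ∈ nv A) × y j ≢ va × y j ≢ vb × y j ≢ vc) ×
    Σ (NV → NV) λ σ →
      (∀ (k : Fin (#nv A)) → σ (at (nv A) (toℕ (ρ ⟨$⟩ʳ k))) ≡ tgt y (toℕ k)) ×
      Taut (sub σ A ⇔ At)

Nontrivial : Fm → Set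
Nontrivial A = ¬ Trivial A

QTCore : (A B : Fm) → Set
QTCore A B =
  Σ (Permutation′ (#nv B)) λ ρ →
  Σ (ℕ → NV) λ u →
    DistinctUpTo (#nv B ∸ #nv A) u ×
    (∀ j → j < #nv B ∸ #nv A → ¬ (u j ∈ nv A) × ¬ (u j ∈ nv B)) ×
    Σ (NV → NV) λ σ →
      (∀ (k : Fin (#nv B)) →
         (toℕ k < #nv A → σ (at (nv B) (toℕ (ρ ⟨$⟩ʳ k))) ≡ at (nv A) (toℕ k)) ×
         (#nv A ≤ toℕ k → σ (at (nv B) (toℕ (ρ ⟨$⟩ʳ k))) ≡ u (toℕ k ∸ #nv A))) ×
      Taut (sub σ B ⇔ A)

QuasiTrivial : Fm → Fm → Set
QuasiTrivial A B =
  3 ≤ #nv A × 3 ≤ #nv B ×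
  ((#nv A ≤ #nv B × QTCore A B) ⊎ (#nv B < #nv A × QTCore B A))

InS : Fm → Set
InS A = Characteristic A × Nontrivial A

-- Reflexivity needs 3 ≤ #nv A, and a characteristic schema has at least three name
-- variables: otherwise each of its instances is a two-name instance of an L1 theorem,
-- and the relation V below validates all those while refuting Ax2.  Everything else is
-- about renamings: QTCore A B says that a renaming σ, bijective from the names of B onto
-- the names of A plus fresh names, turns B into A up to tautological equivalence.  Such
-- σ has a left inverse on the names of B, so renamings can be inverted (equal name
-- counts) and composed (increasing name counts), re-choosing the fresh names
-- canonically; transitivity for decreasing name counts follows by symmetry.
module Submission where

open import Defs
open import Data.Bool using (Bool; true; false; not; _∨_)
open import Data.Empty using (⊥-elim)
open import Data.Fin using (Fin; toℕ; fromℕ<)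
open import Data.Fin.Properties using (toℕ<n; toℕ-fromℕ<; fromℕ<-toℕ; toℕ-injective)
open import Data.Fin.Permutation using (Permutation′; _⟨$⟩ʳ_; _⟨$⟩ˡ_; permutation; inverseˡ; inverseʳ)
open import Data.List using (_∷_; _++_; length)
open import Data.List.Extrema.Nat using (max; xs≤max)
open import Data.List.Membership.Propositional using (_∈_)
open import Data.List.Membership.Propositional.Properties using (∈-++⁺ˡ; ∈-++⁺ʳ; ∈-deduplicate⁺)
import Data.List.Relation.Unary.All as All
open import Data.List.Relation.Unary.AllPairs using (_∷_)
open import Data.List.Relation.Unary.Any using (here; there)
open import Data.List.Relation.Unary.Unique.Propositional using (Unique)
open import Data.List.Relation.Unary.Unique.DecPropositional.Properties using (deduplicate-!)
open import Data.Nat using (ℕ; zero; suc; _∸_; _+_; _<_; _≤_; _≥_; s≤s; z<s; _≟_; _<?_; _≤?_)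
open import Data.Nat.Properties
open import Data.Product using (∃-syntax; ∃₂; _×_; _,_; proj₁; proj₂)
open import Data.Sum using (_⊎_; inj₁; inj₂)
open import Function using (_∘_; id)
open import Relation.Binary.Bundles using (Setoid)
import Relation.Binary.Reasoning.Setoid as SetoidReasoning
open import Relation.Binary.PropositionalEquality
open import Relation.Nullary using (¬_; yes; no; contradiction)

pullback : (NV → NV → Bool) → (NV → NV) → NV → NV → Bool
pullback v σ a b = v (σ a) (σ b)

eval-sub : ∀ v σ φ → eval v (sub σ φ) ≡ eval (pullback v σ) φ
eval-sub v σ (ε a b) = refl
eval-sub v σ (~ φ) = cong not (eval-sub v σ φ)
eval-sub v σ (φ ∨′ ψ) = cong₂ _∨_ (eval-sub v σ φ) (eval-sub v σ ψ)

sub-id : ∀ φ → sub id φ ≡ φ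
sub-id (ε a b) = refl
sub-id (~ φ) = cong ~_ (sub-id φ)
sub-id (φ ∨′ ψ) = cong₂ _∨′_ (sub-id φ) (sub-id ψ)

sub-∘ : ∀ f g φ → sub f (sub g φ) ≡ sub (f ∘ g) φ
sub-∘ f g (ε a b) = refl
sub-∘ f g (~ φ) = cong ~_ (sub-∘ f g φ)
sub-∘ f g (φ ∨′ ψ) = cong₂ _∨′_ (sub-∘ f g φ) (sub-∘ f g ψ)

sub-agree : ∀ {f g} φ → (∀ {a} → a ∈ occ φ → f a ≡ g a) → sub f φ ≡ sub g φ
sub-agree (ε a b) f≗g = cong₂ ε (f≗g (here refl)) (f≗g (there (here refl)))
sub-agree (~ φ) f≗g = cong ~_ (sub-agree φ f≗g)
sub-agree (φ ∨′ ψ) f≗g =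
  cong₂ _∨′_ (sub-agree φ (f≗g ∘ ∈-++⁺ˡ)) (sub-agree ψ (f≗g ∘ ∈-++⁺ʳ (occ φ)))

⊃-intro : ∀ w φ ψ → (eval w φ ≡ true → eval w ψ ≡ true) → eval w (φ ⊃ ψ) ≡ true
⊃-intro w φ ψ with eval w φ
... | false = λ _ → refl
... | true = λ φ⇒ψ → φ⇒ψ refl

⊃-elim : ∀ w φ ψ → eval w (φ ⊃ ψ) ≡ true → eval w φ ≡ true → eval w ψ ≡ true
⊃-elim w φ ψ φ⊃ψ φ-true rewrite φ-true = φ⊃ψ

∧-elim : ∀ w φ ψ → eval w (φ ∧′ ψ) ≡ true → eval w φ ≡ true × eval w ψ ≡ true
∧-elim w φ ψ with eval w φ | eval w ψ
... | true | true = λ _ → refl , refl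
... | true | false = λ ()
... | false | _ = λ ()

infix 4 _≈_

_≈_ : Fm → Fm → Set
φ ≈ ψ = ∀ v → eval v φ ≡ eval v ψ

≈-setoid : Setoid _ _
≈-setoid = record
  { Carrier = Fm
  ; _≈_ = _≈_
  ; isEquivalence = record
    { refl = λ _ → refl
    ; sym = λ φ≈ψ v → sym (φ≈ψ v)
    ; trans = λ φ≈ψ ψ≈χ v → trans (φ≈ψ v) (ψ≈χ v)
    }
  }

module ≈ = Setoid ≈-setoid

≈-sub : ∀ σ {φ ψ} → φ ≈ ψ → sub σ φ ≈ sub σ ψ
≈-sub σ {φ} {ψ} φ≈ψ v = begin
  eval v (sub σ φ)      ≡⟨ eval-sub v σ φ ⟩
  eval (pullback v σ) φ ≡⟨ φ≈ψ (pullback v σ) ⟩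
  eval (pullback v σ) ψ ≡⟨ eval-sub v σ ψ ⟨
  eval v (sub σ ψ)      ∎
  where open ≡-Reasoning

⇔-intro : ∀ w φ ψ → eval w φ ≡ eval w ψ → eval w (φ ⇔ ψ) ≡ true
⇔-intro w φ ψ with eval w φ | eval w ψ
... | false | false = λ _ → refl
... | false | true = λ ()
... | true | false = λ ()
... | true | true = λ _ → refl

⇔-elim : ∀ w φ ψ → eval w (φ ⇔ ψ) ≡ true → eval w φ ≡ eval w ψ
⇔-elim w φ ψ with eval w φ | eval w ψ
... | false | false = λ _ → refl
... | false | true = λ ()
... | true | false = λ ()
... | true | true = λ _ → refl

Taut-⇔⇒≈ : ∀ {φ ψ} → Taut (φ ⇔ ψ) → φ ≈ ψ
Taut-⇔⇒≈ {φ} {ψ} ⊨φ⇔ψ v = ⇔-elim v φ ψ (⊨φ⇔ψ v)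

≈⇒Taut-⇔ : ∀ {φ ψ} → φ ≈ ψ → Taut (φ ⇔ ψ)
≈⇒Taut-⇔ {φ} {ψ} φ≈ψ v = ⇔-intro v φ ψ (φ≈ψ v)

Valid : (NV → NV → Bool) → (Fm → Set) → Set
Valid w Ax = ∀ {φ} → Ax φ → eval w φ ≡ true

Deriv-sound : ∀ {Ax w} → Valid w Ax → ∀ {φ} → Deriv Ax φ → eval w φ ≡ true
Deriv-sound {w = w} valid (taut t) = t w
Deriv-sound valid (ax φ∈Ax) = valid φ∈Ax
Deriv-sound {w = w} valid (mp {φ} {ψ} ⊢φ ⊢φ⊃ψ) =
  ⊃-elim w φ ψ (Deriv-sound valid ⊢φ⊃ψ) (Deriv-sound valid ⊢φ)

at-∈ : ∀ xs {i} → i < length xs → at xs i ∈ xs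
at-∈ (x ∷ xs) {zero} _ = here refl
at-∈ (x ∷ xs) {suc i} (s≤s i<n) = there (at-∈ xs i<n)

∈⇒at : ∀ {xs a} → a ∈ xs → ∃[ i ] i < length xs × at xs i ≡ a
∈⇒at (here refl) = 0 , z<s , refl
∈⇒at (there a∈xs) with ∈⇒at a∈xs
... | i , i<n , refl = suc i , s≤s i<n , refl

at-injective : ∀ {xs} → Unique xs → DistinctUpTo (length xs) (at xs)
at-injective (_ ∷ _) zero zero _ _ _ = refl
at-injective {x ∷ xs} (x∉xs ∷ _) zero (suc j) _ (s≤s j<n) x≡xs[j] =
  ⊥-elim (All.lookup x∉xs (at-∈ xs j<n) x≡xs[j])
at-injective {x ∷ xs} (x∉xs ∷ _) (suc i) zero (s≤s i<n) _ xs[i]≡x =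
  ⊥-elim (All.lookup x∉xs (at-∈ xs i<n) (sym xs[i]≡x))
at-injective (_ ∷ xs!) (suc i) (suc j) (s≤s i<n) (s≤s j<n) eq =
  cong suc (at-injective xs! i j i<n j<n eq)

nvAt : Fm → ℕ → NV
nvAt A = at (nv A)

nvAt-∈ : ∀ A {i} → i < #nv A → nvAt A i ∈ nv A
nvAt-∈ A = at-∈ (nv A)

nvAt-injective : ∀ A → DistinctUpTo (#nv A) (nvAt A)
nvAt-injective A = at-injective (deduplicate-! _≟_ (occ A))

occ⇒nvAt : ∀ A {a} → a ∈ occ A → ∃[ i ] i < #nv A × nvAt A i ≡ a
occ⇒nvAt A a∈A = ∈⇒at (∈-deduplicate⁺ _≟_ a∈A)

sub-agree-nvAt : ∀ A {f g} → (∀ {i} → i < #nv A → f (nvAt A i) ≡ g (nvAt A i)) →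
                 sub f A ≡ sub g A
sub-agree-nvAt A {f} {g} f≗g = sub-agree A agree
  where
  agree : ∀ {a} → a ∈ occ A → f a ≡ g a
  agree a∈A with occ⇒nvAt A a∈A
  ... | i , i<n , refl = f≗g i<n

sub-fix : ∀ A {f} → (∀ {i} → i < #nv A → f (nvAt A i) ≡ nvAt A i) → sub f A ≡ A
sub-fix A f-fixes = trans (sub-agree-nvAt A f-fixes) (sub-id A)

position : (ℕ → NV) → ℕ → NV → ℕ
position s zero w = zero
position s (suc b) w with s b ≟ w
... | yes _ = b
... | no _ = position s b w

position-correct : ∀ {s b k} → DistinctUpTo b s → k < b → position s b (s k) ≡ k
position-correct {s} {suc b} {k} s-inj k<1+b with s b ≟ s k
... | yes sb≡sk = s-inj b k ≤-refl k<1+b sb≡sk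
... | no sb≢sk = position-correct (λ i j i<b j<b → s-inj i j (m<n⇒m<1+n i<b) (m<n⇒m<1+n j<b))
                                  (≤∧≢⇒< (≤-pred k<1+b) (λ k≡b → sb≢sk (cong s (sym k≡b))))

index : Fm → NV → ℕ
index A = position (nvAt A) (#nv A)

index-nvAt : ∀ A {i} → i < #nv A → index A (nvAt A i) ≡ i
index-nvAt A = position-correct (nvAt-injective A)

-- Characteristic schemata have at least three name variables

-- ε read as the symmetric relation on {0, 1, 2} linking every pair except 0 and 2.
-- It refutes Ax2 at (a, b, c) = (0, 1, 2), yet validates every axiom instance that
-- uses at most two distinct names.
V : NV → NV → Bool
V 0 0 = true
V 0 1 = true
V 1 0 = true
V 1 1 = true
V 1 2 = true
V 2 1 = true
V 2 2 = true
V _ _ = false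

V-symmetric : ∀ a b → V a b ≡ true → V b a ≡ true
V-symmetric 0 0 _ = refl
V-symmetric 0 1 _ = refl
V-symmetric 0 (suc (suc _)) ()
V-symmetric 1 0 _ = refl
V-symmetric 1 1 _ = refl
V-symmetric 1 2 _ = refl
V-symmetric 1 (suc (suc (suc _))) ()
V-symmetric 2 0 ()
V-symmetric 2 1 _ = refl
V-symmetric 2 2 _ = refl
V-symmetric 2 (suc (suc (suc _))) ()
V-symmetric (suc (suc (suc _))) _ ()

V-reflexiveˡ : ∀ a b → V a b ≡ true → V a a ≡ true
V-reflexiveˡ 0 _ _ = refl
V-reflexiveˡ 1 _ _ = refl
V-reflexiveˡ 2 _ _ = refl
V-reflexiveˡ (suc (suc (suc _))) _ ()

V-transitive-degenerate : ∀ a b c → a ≡ b ⊎ b ≡ c ⊎ a ≡ c →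
                          V a b ≡ true → V b c ≡ true → V a c ≡ true
V-transitive-degenerate a b c (inj₁ refl) _ Vbc = Vbc
V-transitive-degenerate a b c (inj₂ (inj₁ refl)) Vab _ = Vab
V-transitive-degenerate a b c (inj₂ (inj₂ refl)) Vab _ = V-reflexiveˡ a b Vab

TakesTwoValues : (NV → NV) → Set
TakesTwoValues f = ∃₂ λ p q → ∀ a → f a ≡ p ⊎ f a ≡ q

three-values-collide : ∀ {f} → TakesTwoValues f →
                       ∀ a b c → f a ≡ f b ⊎ f b ≡ f c ⊎ f a ≡ f c
three-values-collide (_ , _ , two) a b c with two a | two b | two c
... | inj₁ fa | inj₁ fb | _ = inj₁ (trans fa (sym fb))
... | inj₂ fa | inj₂ fb | _ = inj₁ (trans fa (sym fb))
... | inj₁ _ | inj₂ fb | inj₂ fc = inj₂ (inj₁ (trans fb (sym fc)))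
... | inj₂ _ | inj₁ fb | inj₁ fc = inj₂ (inj₁ (trans fb (sym fc)))
... | inj₁ fa | inj₂ _ | inj₁ fc = inj₂ (inj₂ (trans fa (sym fc)))
... | inj₂ fa | inj₁ _ | inj₂ fc = inj₂ (inj₂ (trans fa (sym fc)))

V-Ax1 : ∀ g → eval (pullback V g) Ax1 ≡ true
V-Ax1 g = ⊃-intro (pullback V g) (ε va vb) (ε va va) (V-reflexiveˡ (g va) (g vb))

V-Ax2 : ∀ g → g va ≡ g vb ⊎ g vb ≡ g vc ⊎ g va ≡ g vc → eval (pullback V g) Ax2 ≡ true
V-Ax2 g collision = ⊃-intro w (ε va vb ∧′ ε vb vc) (ε va vc) λ ab∧bc →
  let (Vab , Vbc) = ∧-elim w (ε va vb) (ε vb vc) ab∧bc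
  in V-transitive-degenerate (g va) (g vb) (g vc) collision Vab Vbc
  where
  w : NV → NV → Bool
  w = pullback V g

V-Ax3 : ∀ g → eval (pullback V g) Ax3 ≡ true
V-Ax3 g = ⊃-intro w (ε va vb ∧′ ε vb vc) (ε vb va) λ ab∧bc →
  V-symmetric (g va) (g vb) (proj₁ (∧-elim w (ε va vb) (ε vb vc) ab∧bc))
  where
  w : NV → NV → Bool
  w = pullback V g

V-validates-L1Ax : ∀ {f} → TakesTwoValues f → Valid (pullback V f) L1Ax
V-validates-L1Ax {f} _ (inj₁ (τ , refl)) =
  trans (eval-sub (pullback V f) τ Ax1) (V-Ax1 (f ∘ τ))
V-validates-L1Ax {f} two (inj₂ (inj₁ (τ , refl))) =
  trans (eval-sub (pullback V f) τ Ax2) (V-Ax2 (f ∘ τ) (three-values-collide two (τ va) (τ vb) (τ vc)))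
V-validates-L1Ax {f} _ (inj₂ (inj₂ (τ , refl))) =
  trans (eval-sub (pullback V f) τ Ax3) (V-Ax3 (f ∘ τ))

collapse : NV → NV → NV → NV
collapse p q a with a ≟ p
... | yes _ = p
... | no _ = q

collapse-fixes : ∀ p q {a} → a ≡ p ⊎ a ≡ q → collapse p q a ≡ a
collapse-fixes p q {a} a∈pq with a ≟ p | a∈pq
... | yes a≡p | _ = sym a≡p
... | no a≢p | inj₁ a≡p = contradiction a≡p a≢p
... | no _ | inj₂ a≡q = sym a≡q

collapse-takes-two-values : ∀ σ p q → TakesTwoValues (σ ∘ collapse p q)
collapse-takes-two-values σ p q = σ p , σ q , two
  where
  two : ∀ a → σ (collapse p q a) ≡ σ p ⊎ σ (collapse p q a) ≡ σ q
  two a with a ≟ p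
  ... | yes _ = inj₁ refl
  ... | no _ = inj₂ refl

V-validates-instances : ∀ {A} → L1 A → #nv A ≤ 2 → Valid V (Inst A)
V-validates-instances {A} ⊢A n≤2 (σ , refl) = begin
  eval V (sub σ A)                  ≡⟨ cong (eval V) (sub-agree-nvAt A (cong σ ∘ collapse-nvAt)) ⟩
  eval V (sub (σ ∘ c) A)            ≡⟨ eval-sub V (σ ∘ c) A ⟩
  eval (pullback V (σ ∘ c)) A       ≡⟨ Deriv-sound (V-validates-L1Ax (collapse-takes-two-values σ _ _)) ⊢A ⟩
  true                              ∎
  where
  open ≡-Reasoning
  c : NV → NV
  c = collapse (nvAt A 0) (nvAt A 1)
  collapse-nvAt : ∀ {i} → i < #nv A → nvAt A i ≡ c (nvAt A i)
  collapse-nvAt i<n = sym (collapse-fixes _ _ (first-two (≤-trans i<n n≤2)))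
    where
    first-two : ∀ {i} → i < 2 → nvAt A i ≡ nvAt A 0 ⊎ nvAt A i ≡ nvAt A 1
    first-two {0} _ = inj₁ refl
    first-two {1} _ = inj₂ refl
    first-two {suc (suc _)} (s≤s (s≤s ()))

Characteristic⇒3≤#nv : ∀ {A} → Characteristic A → 3 ≤ #nv A
Characteristic⇒3≤#nv {A} A-char with 3 ≤? #nv A
... | yes 3≤n = 3≤n
... | no 3≰n = contradiction (Deriv-sound V-validates-A ⊢Ax2) λ ()
  where
  ⊢A : L1 A
  ⊢A = proj₁ (A-char A) (ax (id , sym (sub-id A)))
  V-validates-A : Valid V (Inst A)
  V-validates-A = V-validates-instances ⊢A (≤-pred (≰⇒> 3≰n))
  ⊢Ax2 : Deriv (Inst A) Ax2
  ⊢Ax2 = proj₂ (A-char Ax2) (ax (inj₂ (inj₁ (id , refl))))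

-- Permutations of {0, …, p − 1}

record IndexPerm (p : ℕ) : Set where
  field
    to from : ℕ → ℕ
    to<     : ∀ {k} → k < p → to k < p
    from<   : ∀ {k} → k < p → from k < p
    to-from : ∀ {k} → k < p → to (from k) ≡ k
    from-to : ∀ {k} → k < p → from (to k) ≡ k

open IndexPerm

idᵢ : ∀ {p} → IndexPerm p
idᵢ = record { to = id ; from = id ; to< = id ; from< = id ; to-from = λ _ → refl ; from-to = λ _ → refl }

flipᵢ : ∀ {p} → IndexPerm p → IndexPerm p
flipᵢ π = record
  { to = from π ; from = to π ; to< = from< π ; from< = to< π ; to-from = from-to π ; from-to = to-from π }

infixr 9 _∘ᵢ_

_∘ᵢ_ : ∀ {p} → IndexPerm p → IndexPerm p → IndexPerm p
π ∘ᵢ ρ = record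
  { to = to ρ ∘ to π
  ; from = from π ∘ from ρ
  ; to< = to< ρ ∘ to< π
  ; from< = from< π ∘ from< ρ
  ; to-from = λ k<p → trans (cong (to ρ) (to-from π (from< ρ k<p))) (to-from ρ k<p)
  ; from-to = λ k<p → trans (cong (from π) (from-to ρ (to< π k<p))) (from-to π k<p)
  }

castᵢ : ∀ {p q} → p ≡ q → IndexPerm p → IndexPerm q
castᵢ refl π = π

from-castᵢ : ∀ {p q} (p≡q : p ≡ q) π {k} → from (castᵢ p≡q π) k ≡ from π k
from-castᵢ refl π = refl

below : ℕ → (ℕ → ℕ) → ℕ → ℕ
below m f k with k <? m
... | yes _ = f k
... | no _ = k

below-< : ∀ {m f k} → k < m → below m f k ≡ f k
below-< {m} {f} {k} k<m with k <? m
... | yes _ = refl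
... | no k≮m = contradiction k<m k≮m

below-≮ : ∀ {m f k} → ¬ k < m → below m f k ≡ k
below-≮ {m} {f} {k} k≮m with k <? m
... | yes k<m = contradiction k<m k≮m
... | no _ = refl

extendᵢ : ∀ {m p} → m ≤ p → IndexPerm m → IndexPerm p
extendᵢ {m} {p} m≤p π = record
  { to = below m (to π)
  ; from = below m (from π)
  ; to< = below-bounded (to< π)
  ; from< = below-bounded (from< π)
  ; to-from = below-inverse (from< π) (to-from π)
  ; from-to = below-inverse (to< π) (from-to π)
  }
  where
  below-bounded : ∀ {f} → (∀ {k} → k < m → f k < m) → ∀ {k} → k < p → below m f k < p
  below-bounded {f} f< {k} k<p with k <? m
  ... | yes k<m = ≤-trans (f< k<m) m≤p
  ... | no _ = k<p
  below-inverse : ∀ {f g} → (∀ {k} → k < m → g k < m) → (∀ {k} → k < m → f (g k) ≡ k) →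
                  ∀ {k} → k < p → below m f (below m g k) ≡ k
  below-inverse {f} {g} g< f∘g {k} _ with k <? m
  ... | yes k<m = trans (below-< (g< k<m)) (f∘g k<m)
  ... | no k≮m = below-≮ k≮m

apply : ∀ {p} → (Fin p → Fin p) → ℕ → ℕ
apply {p} f k with k <? p
... | yes k<p = toℕ (f (fromℕ< k<p))
... | no _ = k

apply-fromℕ< : ∀ {p} (f : Fin p → Fin p) {k} (k<p : k < p) → apply f k ≡ toℕ (f (fromℕ< k<p))
apply-fromℕ< {p} f {k} k<p with k <? p
... | yes _ = refl
... | no k≮p = contradiction k<p k≮p

apply-toℕ : ∀ {p} (f : Fin p → Fin p) i → apply f (toℕ i) ≡ toℕ (f i)
apply-toℕ f i = trans (apply-fromℕ< f (toℕ<n i)) (cong (toℕ ∘ f) (fromℕ<-toℕ i (toℕ<n i)))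

apply-inverse : ∀ {p} (f g : Fin p → Fin p) → (∀ i → f (g i) ≡ i) →
                ∀ {k} → k < p → apply f (apply g k) ≡ k
apply-inverse f g f∘g {k} k<p = begin
  apply f (apply g k)                ≡⟨ cong (apply f) (apply-fromℕ< g k<p) ⟩
  apply f (toℕ (g (fromℕ< k<p)))     ≡⟨ apply-toℕ f (g (fromℕ< k<p)) ⟩
  toℕ (f (g (fromℕ< k<p)))           ≡⟨ cong toℕ (f∘g (fromℕ< k<p)) ⟩
  toℕ (fromℕ< k<p)                   ≡⟨ toℕ-fromℕ< k<p ⟩
  k                                  ∎
  where open ≡-Reasoning

fromPermutation : ∀ {p} → Permutation′ p → IndexPerm p
fromPermutation ρ = record
  { to = apply (ρ ⟨$⟩ʳ_)
  ; from = apply (ρ ⟨$⟩ˡ_)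
  ; to< = λ k<p → subst (_< _) (sym (apply-fromℕ< _ k<p)) (toℕ<n _)
  ; from< = λ k<p → subst (_< _) (sym (apply-fromℕ< _ k<p)) (toℕ<n _)
  ; to-from = apply-inverse _ _ (λ _ → inverseʳ ρ)
  ; from-to = apply-inverse _ _ (λ _ → inverseˡ ρ)
  }

toPermutation : ∀ {p} → IndexPerm p → Permutation′ p
toPermutation {p} π = permutation (onFin (to π) (to< π)) (onFin (from π) (from< π))
  (onFin-inverse (to π) (from π) {to< π} {from< π} (to-from π))
  (onFin-inverse (from π) (to π) {from< π} {to< π} (from-to π))
  where
  onFin : (f : ℕ → ℕ) → (∀ {k} → k < p → f k < p) → Fin p → Fin p
  onFin f f< i = fromℕ< (f< (toℕ<n i))
  onFin-inverse : ∀ f g {f< : ∀ {k} → k < p → f k < p} {g< : ∀ {k} → k < p → g k < p} →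
                  (∀ {k} → k < p → f (g k) ≡ k) → ∀ i → onFin f f< (onFin g g< i) ≡ i
  onFin-inverse f g f∘g i = toℕ-injective (begin
    toℕ (fromℕ< _)               ≡⟨ toℕ-fromℕ< _ ⟩
    f (toℕ (fromℕ< _))           ≡⟨ cong f (toℕ-fromℕ< _) ⟩
    f (g (toℕ i))                ≡⟨ f∘g (toℕ<n i) ⟩
    toℕ i                        ∎)
    where open ≡-Reasoning

toPermutation-toℕ : ∀ {p} (π : IndexPerm p) i → toℕ (toPermutation π ⟨$⟩ʳ i) ≡ to π (toℕ i)
toPermutation-toℕ π i = toℕ-fromℕ< _

-- Renamings

-- The paper's targets x₁, …, xₙ, u₁, u₂, … of a renaming, indexed from 0.
slot : Fm → (ℕ → NV) → ℕ → NV
slot A u k with k <? #nv A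
... | yes _ = nvAt A k
... | no _ = u (k ∸ #nv A)

slot-< : ∀ A u {k} → k < #nv A → slot A u k ≡ nvAt A k
slot-< A u {k} k<n with k <? #nv A
... | yes _ = refl
... | no k≮n = contradiction k<n k≮n

slot-≥ : ∀ A u {k} → #nv A ≤ k → slot A u k ≡ u (k ∸ #nv A)
slot-≥ A u {k} n≤k with k <? #nv A
... | yes k<n = contradiction n≤k (<⇒≱ k<n)
... | no _ = refl

slot-distinct : ∀ A {m u} → DistinctUpTo (m ∸ #nv A) u → (∀ j → j < m ∸ #nv A → ¬ (u j ∈ nv A)) →
                DistinctUpTo m (slot A u)
slot-distinct A {m} {u} u-distinct u∉A i j i<m j<m slot-i≡slot-j
  with i <? #nv A | j <? #nv A
... | yes i<n | yes j<n = nvAt-injective A i j i<n j<n slot-i≡slot-j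
... | yes i<n | no j≮n =
  ⊥-elim (u∉A _ (∸-monoˡ-< j<m (≮⇒≥ j≮n)) (subst (_∈ nv A) slot-i≡slot-j (nvAt-∈ A i<n)))
... | no i≮n | yes j<n =
  ⊥-elim (u∉A _ (∸-monoˡ-< i<m (≮⇒≥ i≮n)) (subst (_∈ nv A) (sym slot-i≡slot-j) (nvAt-∈ A j<n)))
... | no i≮n | no j≮n =
  ∸-cancelʳ-≡ (≮⇒≥ i≮n) (≮⇒≥ j≮n)
    (u-distinct _ _ (∸-monoˡ-< i<m (≮⇒≥ i≮n)) (∸-monoˡ-< j<m (≮⇒≥ j≮n)) slot-i≡slot-j)

-- QTCore A B with the permutation read on indices in ℕ and the two cases of the
-- renaming condition merged into `slot A u`.
record Renaming (A B : Fm) : Set where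
  field
    π          : IndexPerm (#nv B)
    u          : ℕ → NV
    u-distinct : DistinctUpTo (#nv B ∸ #nv A) u
    u-fresh    : ∀ j → j < #nv B ∸ #nv A → ¬ (u j ∈ nv A) × ¬ (u j ∈ nv B)
    σ          : NV → NV
    σ-slot     : ∀ {k} → k < #nv B → σ (nvAt B (to π k)) ≡ slot A u k
    σB≈A       : sub σ B ≈ A

QTCore⇒Renaming : ∀ {A B} → QTCore A B → Renaming A B
QTCore⇒Renaming {A} {B} (ρ , u , u-distinct , u-fresh , σ , σ-ρ , ⊨σB⇔A) = record
  { π = fromPermutation ρ ; u = u ; u-distinct = u-distinct ; u-fresh = u-fresh
  ; σ = σ ; σ-slot = σ-slot ; σB≈A = Taut-⇔⇒≈ {sub σ B} {A} ⊨σB⇔A }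
  where
  σ-slotFin : ∀ i → σ (nvAt B (toℕ (ρ ⟨$⟩ʳ i))) ≡ slot A u (toℕ i)
  σ-slotFin i with toℕ i <? #nv A
  ... | yes i<n = proj₁ (σ-ρ i) i<n
  ... | no i≮n = proj₂ (σ-ρ i) (≮⇒≥ i≮n)
  σ-slot : ∀ {k} → k < #nv B → σ (nvAt B (apply (ρ ⟨$⟩ʳ_) k)) ≡ slot A u k
  σ-slot {k} k<m = begin
    σ (nvAt B (apply (ρ ⟨$⟩ʳ_) k))         ≡⟨ cong (σ ∘ nvAt B) (apply-fromℕ< (ρ ⟨$⟩ʳ_) k<m) ⟩
    σ (nvAt B (toℕ (ρ ⟨$⟩ʳ fromℕ< k<m)))   ≡⟨ σ-slotFin (fromℕ< k<m) ⟩
    slot A u (toℕ (fromℕ< k<m))            ≡⟨ cong (slot A u) (toℕ-fromℕ< k<m) ⟩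
    slot A u k                             ∎
    where open ≡-Reasoning

Renaming⇒QTCore : ∀ {A B} → Renaming A B → QTCore A B
Renaming⇒QTCore {A} {B} R =
  ρ , u , u-distinct , u-fresh , σ , σ-ρ , ≈⇒Taut-⇔ {sub σ B} {A} σB≈A
  where
  open Renaming R
  ρ : Permutation′ (#nv B)
  ρ = toPermutation π
  σ-slotFin : ∀ i → σ (nvAt B (toℕ (ρ ⟨$⟩ʳ i))) ≡ slot A u (toℕ i)
  σ-slotFin i = trans (cong (σ ∘ nvAt B) (toPermutation-toℕ π i)) (σ-slot (toℕ<n i))
  σ-ρ : ∀ i → (toℕ i < #nv A → σ (nvAt B (toℕ (ρ ⟨$⟩ʳ i))) ≡ nvAt A (toℕ i)) ×
              (#nv A ≤ toℕ i → σ (nvAt B (toℕ (ρ ⟨$⟩ʳ i))) ≡ u (toℕ i ∸ #nv A))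
  σ-ρ i = (λ i<n → trans (σ-slotFin i) (slot-< A u i<n)) ,
          (λ n≤i → trans (σ-slotFin i) (slot-≥ A u n≤i))

module _ {A B : Fm} (R : Renaming A B) where
  open Renaming R

  unrename : NV → NV
  unrename w = nvAt B (to π (position (slot A u) (#nv B) w))

  unrename-slot : ∀ {k} → k < #nv B → unrename (slot A u k) ≡ nvAt B (to π k)
  unrename-slot k<m =
    cong (nvAt B ∘ to π) (position-correct (slot-distinct A u-distinct (λ j → proj₁ ∘ u-fresh j)) k<m)

  unrename-nvAt : #nv A ≤ #nv B → ∀ {i} → i < #nv A → unrename (nvAt A i) ≡ nvAt B (to π i)
  unrename-nvAt n≤m i<n = trans (cong unrename (sym (slot-< A u i<n))) (unrename-slot (≤-trans i<n n≤m))

  unrename-σ : ∀ {a} → a ∈ occ B → unrename (σ a) ≡ a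
  unrename-σ a∈B with occ⇒nvAt B a∈B
  ... | i , i<m , refl = begin
    unrename (σ (nvAt B i))                  ≡⟨ cong (unrename ∘ σ ∘ nvAt B) (to-from π i<m) ⟨
    unrename (σ (nvAt B (to π (from π i))))  ≡⟨ cong unrename (σ-slot (from< π i<m)) ⟩
    unrename (slot A u (from π i))           ≡⟨ unrename-slot (from< π i<m) ⟩
    nvAt B (to π (from π i))                 ≡⟨ cong (nvAt B) (to-from π i<m) ⟩
    nvAt B i                                 ∎
    where open ≡-Reasoning

  sub-via-unrename : ∀ τ → sub τ B ≈ sub (τ ∘ unrename) A
  sub-via-unrename τ = begin
    sub τ B                        ≡⟨ sub-agree B (λ a∈B → cong τ (sym (unrename-σ a∈B))) ⟩
    sub (τ ∘ unrename ∘ σ) B       ≡⟨ sub-∘ (τ ∘ unrename) σ B ⟨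
    sub (τ ∘ unrename) (sub σ B)   ≈⟨ ≈-sub (τ ∘ unrename) {sub σ B} {A} σB≈A ⟩
    sub (τ ∘ unrename) A           ∎
    where open SetoidReasoning ≈-setoid

fresh : Fm → Fm → ℕ → NV
fresh A C j = max 0 (nv A ++ nv C) + suc j

fresh-∉ : ∀ A C j → ¬ (fresh A C j ∈ nv A ++ nv C)
fresh-∉ A C j fresh∈ =
  <⇒≱ (m<m+n (max 0 (nv A ++ nv C)) z<s) (All.lookup (xs≤max 0 (nv A ++ nv C)) fresh∈)

fresh-injective : ∀ A C {m} → DistinctUpTo m (fresh A C)
fresh-injective A C i j _ _ eq = suc-injective (+-cancelˡ-≡ (max 0 (nv A ++ nv C)) _ _ eq)

-- The renaming of C determined by π alone; its fresh names avoid both A and C, which the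
-- fresh names of a composed or inverted renaming need not.
canonical : Fm → (C : Fm) → IndexPerm (#nv C) → NV → NV
canonical A C π w = slot A (fresh A C) (from π (index C w))

canonical-nvAt : ∀ A C π {j} → j < #nv C → canonical A C π (nvAt C j) ≡ slot A (fresh A C) (from π j)
canonical-nvAt A C π j<p = cong (slot A (fresh A C) ∘ from π) (index-nvAt C j<p)

canonical-nvAt-to : ∀ A C π {k} → k < #nv C → canonical A C π (nvAt C (to π k)) ≡ slot A (fresh A C) k
canonical-nvAt-to A C π k<p =
  trans (canonical-nvAt A C π (to< π k<p)) (cong (slot A (fresh A C)) (from-to π k<p))

canonicalRenaming : ∀ A C (π : IndexPerm (#nv C)) → sub (canonical A C π) C ≈ A → Renaming A C
canonicalRenaming A C π τC≈A = record
  { π = π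
  ; u = fresh A C
  ; u-distinct = fresh-injective A C
  ; u-fresh = λ j _ → fresh-∉ A C j ∘ ∈-++⁺ˡ , fresh-∉ A C j ∘ ∈-++⁺ʳ (nv A)
  ; σ = canonical A C π
  ; σ-slot = canonical-nvAt-to A C π
  ; σB≈A = τC≈A
  }

Renaming-refl : ∀ A → Renaming A A
Renaming-refl A = canonicalRenaming A A idᵢ (≈.reflexive (sub-fix A canonical-fixes))
  where
  canonical-fixes : ∀ {i} → i < #nv A → canonical A A idᵢ (nvAt A i) ≡ nvAt A i
  canonical-fixes i<n = trans (canonical-nvAt-to A A idᵢ i<n) (slot-< A (fresh A A) i<n)

Renaming-flip : ∀ {A B} → #nv A ≡ #nv B → Renaming A B → Renaming B A
Renaming-flip {A} {B} n≡m R = canonicalRenaming B A π′ τA≈B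
  where
  open Renaming R
  π′ : IndexPerm (#nv A)
  π′ = castᵢ (sym n≡m) (flipᵢ π)
  τ : NV → NV
  τ = canonical B A π′
  τ-nvAt : ∀ {i} → i < #nv A → τ (nvAt A i) ≡ unrename R (nvAt A i)
  τ-nvAt {i} i<n = begin
    τ (nvAt A i)                   ≡⟨ canonical-nvAt B A π′ i<n ⟩
    slot B (fresh B A) (from π′ i) ≡⟨ cong (slot B (fresh B A)) (from-castᵢ (sym n≡m) (flipᵢ π)) ⟩
    slot B (fresh B A) (to π i)    ≡⟨ slot-< B (fresh B A) (to< π i<m) ⟩
    nvAt B (to π i)                ≡⟨ unrename-nvAt R (≤-reflexive n≡m) i<n ⟨
    unrename R (nvAt A i)          ∎
    where
    open ≡-Reasoning
    i<m : i < #nv B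
    i<m = subst (i <_) n≡m i<n
  τA≈B : sub τ A ≈ B
  τA≈B = begin
    sub τ A              ≡⟨ sub-agree-nvAt A τ-nvAt ⟩
    sub (unrename R) A   ≈⟨ sub-via-unrename R id ⟨
    sub id B             ≡⟨ sub-id B ⟩
    B                    ∎
    where open SetoidReasoning ≈-setoid

Renaming-trans : ∀ {A B C} → #nv A ≤ #nv B → #nv B ≤ #nv C → Renaming A B → Renaming B C → Renaming A C
Renaming-trans {A} {B} {C} n≤m m≤p R₁ R₂ = canonicalRenaming A C π τC≈A
  where
  module R₁ = Renaming R₁
  module R₂ = Renaming R₂
  π : IndexPerm (#nv C)
  π = extendᵢ m≤p R₁.π ∘ᵢ R₂.π
  τ : NV → NV
  τ = canonical A C π
  τ-fixes-A : ∀ {i} → i < #nv A → τ (unrename R₂ (unrename R₁ (nvAt A i))) ≡ nvAt A i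
  τ-fixes-A {i} i<n = begin
    τ (unrename R₂ (unrename R₁ (nvAt A i)))  ≡⟨ cong (τ ∘ unrename R₂) (unrename-nvAt R₁ n≤m i<n) ⟩
    τ (unrename R₂ (nvAt B (to R₁.π i)))      ≡⟨ cong τ (unrename-nvAt R₂ m≤p (to< R₁.π i<m)) ⟩
    τ (nvAt C (to R₂.π (to R₁.π i)))          ≡⟨ cong (τ ∘ nvAt C ∘ to R₂.π) (below-< i<m) ⟨
    τ (nvAt C (to π i))                       ≡⟨ canonical-nvAt-to A C π (≤-trans i<m m≤p) ⟩
    slot A (fresh A C) i                      ≡⟨ slot-< A (fresh A C) i<n ⟩
    nvAt A i                                  ∎
    where
    open ≡-Reasoning
    i<m : i < #nv B
    i<m = ≤-trans i<n n≤m
  τC≈A : sub τ C ≈ A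
  τC≈A = begin
    sub τ C                                 ≈⟨ sub-via-unrename R₂ τ ⟩
    sub (τ ∘ unrename R₂) B                 ≈⟨ sub-via-unrename R₁ (τ ∘ unrename R₂) ⟩
    sub (τ ∘ unrename R₂ ∘ unrename R₁) A   ≡⟨ sub-fix A τ-fixes-A ⟩
    A                                       ∎
    where open SetoidReasoning ≈-setoid

QuasiTrivial⇒QTCore : ∀ {A B} → #nv A ≤ #nv B → QuasiTrivial A B → QTCore A B
QuasiTrivial⇒QTCore _ (_ , _ , inj₁ (_ , core)) = core
QuasiTrivial⇒QTCore n≤m (_ , _ , inj₂ (m<n , _)) = contradiction n≤m (<⇒≱ m<n)

QuasiTrivial-refl : ∀ {A} → 3 ≤ #nv A → QuasiTrivial A A
QuasiTrivial-refl {A} 3≤n = 3≤n , 3≤n , inj₁ (≤-refl , Renaming⇒QTCore {A} {A} (Renaming-refl A))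

QuasiTrivial-sym : ∀ {A B} → QuasiTrivial A B → QuasiTrivial B A
QuasiTrivial-sym (3≤n , 3≤m , inj₂ (m<n , core)) = 3≤m , 3≤n , inj₁ (<⇒≤ m<n , core)
QuasiTrivial-sym {A} {B} (3≤n , 3≤m , inj₁ (n≤m , core)) with m≤n⇒m<n∨m≡n n≤m
... | inj₁ n<m = 3≤m , 3≤n , inj₂ (n<m , core)
... | inj₂ n≡m = 3≤m , 3≤n , inj₁ (≤-reflexive (sym n≡m) , Renaming⇒QTCore {B} {A} R⁻¹)
  where
  R⁻¹ : Renaming B A
  R⁻¹ = Renaming-flip n≡m (QTCore⇒Renaming {A} {B} core)

QuasiTrivial-trans-≤ : ∀ {A B C} → #nv A ≤ #nv B → #nv B ≤ #nv C →
                       QuasiTrivial A B → QuasiTrivial B C → QuasiTrivial A C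
QuasiTrivial-trans-≤ {A} {B} {C} n≤m m≤p qt₁@(3≤n , _) qt₂@(_ , 3≤p , _) =
  3≤n , 3≤p , inj₁ (≤-trans n≤m m≤p , Renaming⇒QTCore {A} {C} (Renaming-trans n≤m m≤p R₁ R₂))
  where
  R₁ : Renaming A B
  R₁ = QTCore⇒Renaming {A} {B} (QuasiTrivial⇒QTCore {A} {B} n≤m qt₁)
  R₂ : Renaming B C
  R₂ = QTCore⇒Renaming {B} {C} (QuasiTrivial⇒QTCore {B} {C} m≤p qt₂)

QuasiTrivial-trans-≥ : ∀ {A B C} → #nv A ≥ #nv B → #nv B ≥ #nv C →
                       QuasiTrivial A B → QuasiTrivial B C → QuasiTrivial A C
QuasiTrivial-trans-≥ {A} {B} {C} n≥m m≥p qt₁ qt₂ =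
  QuasiTrivial-sym {C} {A}
    (QuasiTrivial-trans-≤ {C} {B} {A} m≥p n≥m (QuasiTrivial-sym {B} {C} qt₂) (QuasiTrivial-sym {A} {B} qt₁))

proposition4p2 : ∀ (x y z : Fm) → InS x → InS y → InS z →
    (QuasiTrivial x x × (QuasiTrivial x y → QuasiTrivial y x)) ×
    (#nv x ≤ #nv y → #nv y ≤ #nv z → QuasiTrivial x y → QuasiTrivial y z → QuasiTrivial x z) ×
    (#nv x ≥ #nv y → #nv y ≥ #nv z → QuasiTrivial x y → QuasiTrivial y z → QuasiTrivial x z)
proposition4p2 x y z (x-characteristic , _) _ _ =
  (QuasiTrivial-refl {x} (Characteristic⇒3≤#nv x-characteristic) , QuasiTrivial-sym {x} {y}) ,
  QuasiTrivial-trans-≤ {x} {y} {z} ,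
  QuasiTrivial-trans-≥ {x} {y} {z}
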